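{- Let $\mathbf P=(P,\leq,{}',0,1)$ be a finite orthomodular poset which is not a lattice. Then its Dedekind-MacNeille completion $\mathrm{DM}(\mathbf P)$ is not orthomodular.
   Context: A poset with complementation is a bounded poset with an antitone involution $'$ ($x\leq y\Rightarrow y'\leq x'$, $x''=x$) such that the only common lower bound of $x,x'$ is $0$ and the only common upper bound is $1$. An orthomodular poset is a poset with complementation in which $x\vee y$ exists whenever $x\leq y'$, and in which $x\leq y$ implies $y=x\vee(y\wedge x')$ (where $y\wedge x'=(y'\vee x)'$). The Dedekind-MacNeille completion $\mathrm{DM}(\mathbf P)$ is the complete lattice $(\{B\subseteq P\mid L(U(B))=B\},\subseteq)$, where $U,L$ denote the sets of upper and lower bounds in $P$, with $P$ embedded via $x\mapsto L(x)$ and complementation $X\mapsto L(\{x'\mid x\in X\})$; a lattice with complementation is orthomodular if $x\vee y=((x\vee y)\wedge y')\vee y$ for all $x,y$. -}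

module Defs where

open import Data.Product using (Σ; _×_; _,_)
open import Data.Sum using (_⊎_)
open import Relation.Nullary using (¬_)
open import Relation.Binary.PropositionalEquality using (_≡_)

Pred : Set → Set₁
Pred A = A → Set

record PosetWithComplementation (A : Set) : Set₁ where
  field
    _≤_       : A → A → Set
    ≤-refl    : ∀ x → x ≤ x
    ≤-antisym : ∀ {x y} → x ≤ y → y ≤ x → x ≡ y
    ≤-trans   : ∀ {x y z} → x ≤ y → y ≤ z → x ≤ z
    𝟘 𝟙       : A
    𝟘-least   : ∀ x → 𝟘 ≤ x
    𝟙-greatest : ∀ x → x ≤ 𝟙
    _′        : A → A
    antitone  : ∀ {x y} → x ≤ y → (y ′) ≤ (x ′)
    involutive : ∀ x → (x ′) ′ ≡ x
    lower-compl : ∀ x z → z ≤ x → z ≤ (x ′) → z ≡ 𝟘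
    upper-compl : ∀ x z → x ≤ z → (x ′) ≤ z → z ≡ 𝟙

  infix 4 _≤_

  IsSup : A → A → A → Set
  IsSup x y s = x ≤ s × y ≤ s × (∀ z → x ≤ z → y ≤ z → s ≤ z)

  IsInf : A → A → A → Set
  IsInf x y i = i ≤ x × i ≤ y × (∀ z → z ≤ x → z ≤ y → z ≤ i)

  IsLattice : Set
  IsLattice = ∀ x y → Σ A (IsSup x y) × Σ A (IsInf x y)

  U : Pred A → Pred A
  U B u = ∀ b → B b → b ≤ u

  L : Pred A → Pred A
  L C l = ∀ c → C c → l ≤ c

  -- Elements of DM(P): subsets B with L(U(B)) = B
  IsDMClosed : Pred A → Set
  IsDMClosed B = ∀ x → (L (U B) x → B x) × (B x → L (U B) x)

  _≐_ : Pred A → Pred A → Set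
  X ≐ Y = ∀ z → (X z → Y z) × (Y z → X z)

  -- Lattice operations of DM(P) (complete lattice under ⊆):
  -- meet = intersection, join = L(U(X ∪ Y)), complement X ↦ L({x′ | x ∈ X}).
  _⊓_ : Pred A → Pred A → Pred A
  (X ⊓ Y) z = X z × Y z

  _⊔_ : Pred A → Pred A → Pred A
  X ⊔ Y = L (U (λ z → X z ⊎ Y z))

  compl : Pred A → Pred A
  compl X = L (λ c → Σ A (λ x → X x × c ≡ x ′))

  DMOrthomodular : Set₁
  DMOrthomodular = ∀ X Y → IsDMClosed X → IsDMClosed Y →
    (X ⊔ Y) ≐ (((X ⊔ Y) ⊓ compl Y) ⊔ Y)

record OrthomodularPoset (A : Set) : Set₁ where
  field
    pwc : PosetWithComplementation A
  open PosetWithComplementation pwc public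
  field
    orthojoin : ∀ x y → x ≤ y ′ → Σ A (IsSup x y)
    -- x ≤ y implies y = x ∨ (y ∧ x′), where y ∧ x′ = (y′ ∨ x)′
    orthomodular : ∀ x y → x ≤ y →
      ∀ s → IsSup (y ′) x s → ∀ t → IsSup x (s ′) t → y ≡ t

module Submission where

-- If DM(P) is orthomodular, then every pair x, y of a finite orthomodular
-- poset P has a join (and hence, by complementation, a meet), so P is a
-- lattice; the corollary is the contrapositive.
--
-- The join of x and y in DM(P) is the closed set X = L(U{x, y}).  Take a
-- maximal element m of X (it exists because P is finite).  Inside DM(P),
-- the element (X ∨ ↓m) ∧ (↓m)′ is 0: any z in it lies in X and below m′,
-- so z ∨ m exists (orthojoin), lies in X, is above m, hence equals m by
-- maximality, forcing z ≤ m ∧ m′ = 0.  Orthomodularity of DM(P) then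
-- gives X ⊆ X ∨ ↓m = 0 ∨ ↓m = ↓m, so m is the greatest element of X,
-- which is exactly the statement that m is the join of x and y.
--
-- Choosing a maximal element needs excluded middle for the order, so the
-- argument runs in the double-negation monad (enough, as the goal is a
-- negation).

open import Defs
open import Data.Nat using (ℕ)
open import Data.Fin using (Fin)
open import Data.Product using (Σ; _×_; _,_; proj₁; proj₂)
open import Data.Sum using (_⊎_; inj₁; inj₂)
open import Data.List using (List; []; _∷_; allFin)
open import Data.List.Relation.Unary.Any using (here; there)
open import Data.List.Membership.Propositional using (_∈_)
open import Data.List.Membership.Propositional.Properties using (∈-allFin)
open import Effect.Monad using (RawMonad)
open import Level using (0ℓ)
open import Relation.Nullary using (¬_; yes; no; contradiction)
open import Relation.Nullary.Decidable using (¬¬-excluded-middle)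
open import Relation.Nullary.Negation using (¬¬-Monad)
open import Relation.Binary.PropositionalEquality using (_≡_; refl; subst; sym)

open RawMonad (¬¬-Monad {0ℓ})

¬¬-all-in : {A : Set} {B : A → Set} (ls : List A) →
  (∀ x → x ∈ ls → ¬ ¬ B x) → ¬ ¬ (∀ x → x ∈ ls → B x)
¬¬-all-in [] f = pure (λ _ ())
¬¬-all-in (c ∷ ls) f = do
  Bc ← f c (here refl)
  Bls ← ¬¬-all-in ls (λ x x∈ls → f x (there x∈ls))
  pure λ { x (here refl) → Bc ; x (there x∈ls) → Bls x x∈ls }

module Maximality {A : Set} (_≤_ : A → A → Set)
  (≤-refl : ∀ x → x ≤ x) (≤-trans : ∀ {x y z} → x ≤ y → y ≤ z → x ≤ z) where

  MaximalIn : List A → Pred A → A → Set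
  MaximalIn ls X m = ∀ c → c ∈ ls → X c → m ≤ c → c ≤ m

  -- A nonempty predicate has (classically) a maximal element among the
  -- members of any list: scan the list, moving up whenever possible.
  ¬¬-maximal : (X : Pred A) {a : A} → X a → (ls : List A) →
    ¬ ¬ Σ A (λ m → X m × MaximalIn ls X m)
  ¬¬-maximal X Xa [] = pure (_ , Xa , λ c ())
  ¬¬-maximal X Xa (c ∷ ls) = do
    (m , Xm , maximal) ← ¬¬-maximal X Xa ls
    yes (Xc , m≤c) ← ¬¬-excluded-middle {A = X c × m ≤ c}
      where no ¬c-above → pure (m , Xm , λ where
              d (here refl) Xd m≤d → contradiction (Xd , m≤d) ¬c-above
              d (there d∈ls) → maximal d d∈ls)
    pure (c , Xc , λ where
      d (here refl) _ _ → ≤-refl c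
      d (there d∈ls) Xd c≤d → ≤-trans (maximal d d∈ls Xd (≤-trans m≤c c≤d)) m≤c)

module Completion {A : Set} (P : PosetWithComplementation A)
  (orthojoin : ∀ x y → PosetWithComplementation._≤_ P x (PosetWithComplementation._′ P y) →
               Σ A (PosetWithComplementation.IsSup P x y)) where
  open PosetWithComplementation P

  -- The principal down-set ↓m, the image of m in DM(P).
  ↓ : A → Pred A
  ↓ m z = z ≤ m

  Maximal : Pred A → A → Set
  Maximal X m = ∀ c → X c → m ≤ c → c ≤ m

  LU-closed : ∀ S → IsDMClosed (L (U S))
  LU-closed S z = (λ z∈LULUS u u∈US → z∈LULUS u (λ l l∈LUS → l∈LUS u u∈US))
                , (λ z∈LUS u u∈ULUS → u∈ULUS z z∈LUS)

  ↓-closed : ∀ m → IsDMClosed (↓ m)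
  ↓-closed m z = (λ z∈LU↓m → z∈LU↓m m (λ b b≤m → b≤m))
               , (λ z≤m u u∈U↓m → u∈U↓m z z≤m)

  ⊆-⊔ˡ : ∀ X Y z → X z → (X ⊔ Y) z
  ⊆-⊔ˡ X Y z Xz u u∈U = u∈U z (inj₁ Xz)

  closed-under-sup : ∀ {X} → IsDMClosed X → ∀ {a b s} → X a → X b → IsSup a b s → X s
  closed-under-sup {X} closed {a} {b} {s} Xa Xb (_ , _ , least) =
    proj₁ (closed s) (λ u u∈UX → least u (below a Xa u u∈UX) (below b Xb u u∈UX))
    where
      below : ∀ w → X w → ∀ u → U X u → w ≤ u
      below w Xw u u∈UX = proj₂ (closed w) Xw u u∈UX

  ⊔-↓-absorbed : ∀ {X m} → IsDMClosed X → X m → ∀ z → (X ⊔ ↓ m) z → X z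
  ⊔-↓-absorbed {X} {m} closed Xm z z∈X⊔↓m = proj₁ (closed z) λ u u∈UX →
    z∈X⊔↓m u λ where
      b (inj₁ Xb) → u∈UX b Xb
      b (inj₂ b≤m) → ≤-trans b≤m (u∈UX m Xm)

  maximal-orthocomplement-trivial : ∀ {X m} → IsDMClosed X → X m → Maximal X m →
    ∀ z → ((X ⊔ ↓ m) ⊓ compl (↓ m)) z → z ≡ 𝟘
  maximal-orthocomplement-trivial {X} {m} closed Xm maximal z (z∈X⊔↓m , z∈↓m′) =
    lower-compl m z z≤m z≤m′
    where
      z≤m′ : z ≤ m ′
      z≤m′ = z∈↓m′ (m ′) (m , ≤-refl m , refl)
      z∨m : Σ A (IsSup z m)
      z∨m = orthojoin z m z≤m′
      s : A
      s = proj₁ z∨m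
      z≤s : z ≤ s
      z≤s = proj₁ (proj₂ z∨m)
      m≤s : m ≤ s
      m≤s = proj₁ (proj₂ (proj₂ z∨m))
      Xs : X s
      Xs = closed-under-sup closed (⊔-↓-absorbed closed Xm z z∈X⊔↓m) Xm (proj₂ z∨m)
      z≤m : z ≤ m
      z≤m = ≤-trans z≤s (maximal s Xs m≤s)

  -- In an orthomodular DM(P), a maximal element of a closed set is its
  -- greatest element: X ⊆ X ∨ ↓m = ((X ∨ ↓m) ∧ (↓m)′) ∨ ↓m = 0 ∨ ↓m = ↓m.
  maximal-is-greatest : DMOrthomodular → ∀ {X m} → IsDMClosed X → X m → Maximal X m →
    ∀ w → X w → w ≤ m
  maximal-is-greatest dm {X} {m} closed Xm maximal w Xw =
    proj₁ (dm X (↓ m) closed (↓-closed m) w) (⊆-⊔ˡ X (↓ m) w Xw) m m-bounds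
    where
      m-bounds : U (λ b → ((X ⊔ ↓ m) ⊓ compl (↓ m)) b ⊎ ↓ m b) m
      m-bounds b (inj₁ b∈rel) =
        subst (_≤ m) (sym (maximal-orthocomplement-trivial closed Xm maximal b b∈rel)) (𝟘-least m)
      m-bounds b (inj₂ b≤m) = b≤m

  -- The closed set L(U{x, y}), the join of ↓x and ↓y in DM(P).
  common-lower : A → A → Pred A
  common-lower x y = L (U (λ z → z ≡ x ⊎ z ≡ y))

  maximal-is-sup : DMOrthomodular → ∀ x y {m} → common-lower x y m →
    Maximal (common-lower x y) m → IsSup x y m
  maximal-is-sup dm x y {m} m∈X maximal =
    greatest x (inj₁ refl) , greatest y (inj₂ refl) , λ u x≤u y≤u → m∈X u (bound x≤u y≤u)
    where
      greatest : ∀ w → w ≡ x ⊎ w ≡ y → w ≤ m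
      greatest w w∈xy =
        maximal-is-greatest dm (LU-closed _) m∈X maximal w (λ u u∈U → u∈U w w∈xy)
      bound : ∀ {u} → x ≤ u → y ≤ u → U (λ z → z ≡ x ⊎ z ≡ y) u
      bound x≤u y≤u _ (inj₁ refl) = x≤u
      bound x≤u y≤u _ (inj₂ refl) = y≤u

  inf-from-sup′ : ∀ x y → Σ A (IsSup (x ′) (y ′)) → Σ A (IsInf x y)
  inf-from-sup′ x y (s , x′≤s , y′≤s , least) =
    s ′ , below x (antitone x′≤s) , below y (antitone y′≤s) ,
    λ z z≤x z≤y → subst (_≤ s ′) (involutive z) (antitone (least (z ′) (antitone z≤x) (antitone z≤y)))
    where
      below : ∀ w → s ′ ≤ w ′ ′ → s ′ ≤ w
      below w = subst (s ′ ≤_) (involutive w)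

  module Finite (elems : List A) (complete : ∀ x → x ∈ elems) where
    open Maximality _≤_ ≤-refl ≤-trans

    -- Any two elements have a join: a maximal element of L(U{x, y}) above 0.
    ¬¬-sup : DMOrthomodular → ∀ x y → ¬ ¬ Σ A (IsSup x y)
    ¬¬-sup dm x y = do
      (m , m∈X , maximal) ← ¬¬-maximal (common-lower x y) (λ u _ → 𝟘-least u) elems
      pure (m , maximal-is-sup dm x y m∈X (λ c → maximal c (complete c)))

    ¬¬-lattice : DMOrthomodular → ¬ ¬ IsLattice
    ¬¬-lattice dm = do
      pairs ← ¬¬-all-in elems λ x _ → ¬¬-all-in elems λ y _ → do
        sup ← ¬¬-sup dm x y
        sup′ ← ¬¬-sup dm (x ′) (y ′)
        pure (sup , inf-from-sup′ x y sup′)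
      pure λ x y → pairs x (complete x) y (complete y)

corollary2 : (n : ℕ) (P : OrthomodularPoset (Fin n)) →
    ¬ OrthomodularPoset.IsLattice P → ¬ OrthomodularPoset.DMOrthomodular P
corollary2 n P not-lattice dm = ¬¬-lattice dm not-lattice
  where
    open OrthomodularPoset P using (pwc; orthojoin)
    open Completion pwc orthojoin using (module Finite)
    open Finite (allFin n) ∈-allFin using (¬¬-lattice)
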